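{- Let $G=(L,R,E)$ be any bipartite graph with $n$ vertices and $m=|E|$ edges and let $\varepsilon\in(0,1)$. Run the following algorithm. Set importances $q^{(1)}_e=1$ for every $e\in E$ and $Q^{(1)}=\sum_{e\in E}q^{(1)}_e$. For $r=1,\dots,\mathcal{R}$ where $\mathcal{R}=\frac{4}{\varepsilon}\log_2 m$: (a) sample each edge $e\in E$ independently with probability $p^{(r)}_e=\frac{2n}{\varepsilon}\cdot\frac{q^{(r)}_e}{Q^{(r)}}$; (b) compute a maximum matching $M^{(r)}$ and a minimum vertex cover $U^{(r)}$ of the graph formed by the sampled edges; (c) for every edge $e\in E$ with neither endpoint in $U^{(r)}$ set $q^{(r+1)}_e=2q^{(r)}_e$, and for all other edges set $q^{(r+1)}_e=q^{(r)}_e$; let $Q^{(r+1)}=\sum_{e\in E}q^{(r+1)}_e$. Suppose that in every iteration $r\in\{1,\dots,\mathcal{R}\}$ we have $|M^{(r)}|<(1-\varepsilon)\cdot\mu(G)$, where $\mu(G)$ is the maximum matching size of $G$. Then there exists at least one edge $e\in E$ with $q^{(\mathcal{R}+1)}_e\ge 2^{\varepsilon\cdot\mathcal{R}}$.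
   Context: A vertex cover of a graph is a set of vertices containing at least one endpoint of every edge.
   Formalization: The parameter ε ranges over the rationals in (0,1) rather than over all reals in (0,1). -}

module Defs where

open import Data.Nat using (ℕ; zero; suc; _+_; _*_; _≤_)
open import Data.Fin using (Fin)
open import Data.Fin.Subset using (Subset; _∈_; _⊆_; ∣_∣)
open import Data.Product using (_×_; proj₁; proj₂; _,_)
open import Data.Bool using (Bool; true; false; _∨_; if_then_else_)
open import Data.Vec using (lookup)
open import Relation.Binary.PropositionalEquality using (_≡_; _≢_)

-- A bipartite graph G = (L, R, E) with L = Fin nL, R = Fin nR and
-- m edges, edge i being E i = (left endpoint , right endpoint).
EdgeList : ℕ → ℕ → ℕ → Set
EdgeList nL nR m = Fin m → Fin nL × Fin nR

module _ {nL nR m : ℕ} (E : EdgeList nL nR m) where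

  IsMatchingIn : Subset m → Subset m → Set
  IsMatchingIn S M = M ⊆ S × (∀ {e e'} → e ∈ M → e' ∈ M → e ≢ e' →
                       (proj₁ (E e) ≢ proj₁ (E e')) × (proj₂ (E e) ≢ proj₂ (E e')))

  IsMaximumMatchingIn : Subset m → Subset m → Set
  IsMaximumMatchingIn S M =
    IsMatchingIn S M × (∀ M' → IsMatchingIn S M' → ∣ M' ∣ ≤ ∣ M ∣)

  VSet : Set
  VSet = Subset nL × Subset nR

  vsize : VSet → ℕ
  vsize (UL , UR) = ∣ UL ∣ + ∣ UR ∣

  covers : VSet → Fin m → Bool
  covers (UL , UR) e = lookup UL (proj₁ (E e)) ∨ lookup UR (proj₂ (E e))

  IsVertexCoverOf : Subset m → VSet → Set
  IsVertexCoverOf S U = ∀ {e} → e ∈ S → covers U e ≡ true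

  IsMinimumVertexCoverOf : Subset m → VSet → Set
  IsMinimumVertexCoverOf S U =
    IsVertexCoverOf S U × (∀ U' → IsVertexCoverOf S U' → vsize U ≤ vsize U')

  -- importances: q U r e = q^{(r+1)}_e, where U r = U^{(r+1)} is the cover
  -- computed in iteration r+1 (0-based indexing of iterations).
  importance : (ℕ → VSet) → ℕ → Fin m → ℕ
  importance U zero e = 1
  importance U (suc r) e =
    if covers (U r) e then importance U r e else 2 * importance U r e

{-# OPTIONS --safe #-}
-- By Kőnig's theorem the minimum cover U⁽ʳ⁾ of the sampled graph is no larger than
-- its maximum matching M⁽ʳ⁾, and a set of vertices covers at most as many edges of a
-- maximum matching M* of G as it has elements. As |M⁽ʳ⁾| < (1 − ε) μ(G), more than
-- ε μ(G) edges of M* are left uncovered, and hence doubled, in every round. Over R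
-- rounds the edges of M* are doubled more than ε R μ(G) times in total, so one of
-- them is doubled more than ε R times.
module Submission where

open import Defs
open import Data.Nat using (ℕ; zero; suc; _+_; _*_; _^_; _≤_; _<_; _∸_; z≤n; s≤s; z<s)
open import Data.Nat.Properties hiding (_≟_; suc-injective; 0≢1+n)
open import Data.Bool using (Bool; true; false; if_then_else_)
open import Data.Bool.Properties using (∨-zeroʳ)
open import Data.Fin using (Fin; zero; suc; fromℕ<; _≟_)
open import Data.Fin.Properties using (0≢1+n; suc-injective; any?)
open import Data.Fin.Subset
open import Data.Fin.Subset.Properties
open import Data.Product using (Σ; ∃; ∃₂; _×_; _,_; proj₁; proj₂; map)
open import Data.Sum using (_⊎_; inj₁; inj₂)
open import Data.Vec using ([]; _∷_; here; there; lookup; tabulate)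
open import Data.Vec.Properties using (lookup∘tabulate; lookup⇒[]=; []=⇒lookup)
open import Function using (_∘_; case_of_)
open import Function.Definitions using (Injective)
open import Relation.Binary.PropositionalEquality using (_≡_; _≢_; refl; sym; trans; cong; subst)
open import Relation.Nullary using (yes; no; ¬_; contradiction; ¬?; _×-dec_)
open import Relation.Nullary.Decidable using (does; dec-true)
open import Relation.Unary using (Pred; Decidable)

private
  variable
    k n : ℕ

∈-tabulate⁺ : ∀ {f : Fin n → Bool} {x} → f x ≡ true → x ∈ tabulate f
∈-tabulate⁺ {f = f} {x} fx = lookup⇒[]= x (tabulate f) (trans (lookup∘tabulate f x) fx)

∈-tabulate⁻ : ∀ {f : Fin n → Bool} {x} → x ∈ tabulate f → f x ≡ true
∈-tabulate⁻ {f = f} {x} x∈ = trans (sym (lookup∘tabulate f x)) ([]=⇒lookup x∈)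

subsetOf : ∀ {ℓ} {P : Pred (Fin n) ℓ} → Decidable P → Subset n
subsetOf P? = tabulate (does ∘ P?)

∈-subsetOf⁺ : ∀ {ℓ} {P : Pred (Fin n) ℓ} (P? : Decidable P) {x} → P x → x ∈ subsetOf P?
∈-subsetOf⁺ P? Px = ∈-tabulate⁺ (dec-true (P? _) Px)

∈-subsetOf⁻ : ∀ {ℓ} {P : Pred (Fin n) ℓ} (P? : Decidable P) {x} → x ∈ subsetOf P? → P x
∈-subsetOf⁻ P? {x} x∈ with P? x | ∈-tabulate⁻ {f = does ∘ P?} x∈
... | yes Px | _ = Px

∣p∣≡∣p∩q∣+∣p─q∣ : ∀ (p q : Subset n) → ∣ p ∣ ≡ ∣ p ∩ q ∣ + ∣ p ─ q ∣
∣p∣≡∣p∩q∣+∣p─q∣ []            []            = refl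
∣p∣≡∣p∩q∣+∣p─q∣ (inside  ∷ p) (inside  ∷ q) = cong suc (∣p∣≡∣p∩q∣+∣p─q∣ p q)
∣p∣≡∣p∩q∣+∣p─q∣ (inside  ∷ p) (outside ∷ q) =
  trans (cong suc (∣p∣≡∣p∩q∣+∣p─q∣ p q)) (sym (+-suc ∣ p ∩ q ∣ ∣ p ─ q ∣))
∣p∣≡∣p∩q∣+∣p─q∣ (outside ∷ p) (inside  ∷ q) = ∣p∣≡∣p∩q∣+∣p─q∣ p q
∣p∣≡∣p∩q∣+∣p─q∣ (outside ∷ p) (outside ∷ q) = ∣p∣≡∣p∩q∣+∣p─q∣ p q

∣p∣≤1+∣p-x∣ : ∀ (p : Subset n) x → ∣ p ∣ ≤ suc ∣ p - x ∣
∣p∣≤1+∣p-x∣ p x = begin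
  ∣ p ∣                     ≡⟨ ∣p∣≡∣p∩q∣+∣p─q∣ p ⁅ x ⁆ ⟩
  ∣ p ∩ ⁅ x ⁆ ∣ + ∣ p - x ∣ ≤⟨ +-monoˡ-≤ ∣ p - x ∣ (∣p∩q∣≤∣q∣ p ⁅ x ⁆) ⟩
  ∣ ⁅ x ⁆ ∣ + ∣ p - x ∣     ≡⟨ cong (_+ ∣ p - x ∣) (∣⁅x⁆∣≡1 x) ⟩
  suc ∣ p - x ∣             ∎
  where open ≤-Reasoning

x∈p─q⇒x∉q : ∀ {x : Fin n} (p q : Subset n) → x ∈ p ─ q → x ∉ q
x∈p─q⇒x∉q (_ ∷ p) (outside ∷ q) here          ()
x∈p─q⇒x∉q (_ ∷ p) (outside ∷ q) (there x∈p─q) (there x∈q) = x∈p─q⇒x∉q p q x∈p─q x∈q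
x∈p─q⇒x∉q (_ ∷ p) (inside  ∷ q) (there x∈p─q) (there x∈q) = x∈p─q⇒x∉q p q x∈p─q x∈q

x∉p-x : ∀ {p : Subset n} x → x ∉ p - x
x∉p-x {p = _ ∷ _} zero    ()
x∉p-x {p = _ ∷ _} (suc x) (there x∈p-x) = x∉p-x x x∈p-x

x∈p∪⁅y⁆⇒x∈p⊎x≡y : ∀ (p : Subset n) {x} y → x ∈ p ∪ ⁅ y ⁆ → x ∈ p ⊎ x ≡ y
x∈p∪⁅y⁆⇒x∈p⊎x≡y p y x∈ with x∈p∪q⁻ p ⁅ y ⁆ x∈
... | inj₁ x∈p   = inj₁ x∈p
... | inj₂ x∈⁅y⁆ = inj₂ (x∈⁅y⁆⇒x≡y y x∈⁅y⁆)

injection⇒∣p∣≤∣q∣ : ∀ (f : Fin k → Fin n) {p q} →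
                    (∀ {x} → x ∈ p → f x ∈ q) →
                    (∀ {x y} → x ∈ p → y ∈ p → f x ≡ f y → x ≡ y) →
                    ∣ p ∣ ≤ ∣ q ∣
injection⇒∣p∣≤∣q∣ f {[]}          into inj = z≤n
injection⇒∣p∣≤∣q∣ f {outside ∷ p} into inj =
  injection⇒∣p∣≤∣q∣ (f ∘ suc) (into ∘ there)
    λ x∈p y∈p eq → suc-injective (inj (there x∈p) (there y∈p) eq)
injection⇒∣p∣≤∣q∣ f {inside  ∷ p} {q} into inj = ≤-trans (s≤s rest) (x∈p⇒∣p-x∣<∣p∣ (into here))
  where
  into′ : ∀ {x} → x ∈ p → f (suc x) ∈ q - f zero
  into′ x∈p = x∈p∧x≢y⇒x∈p-y (into (there x∈p)) λ eq → 0≢1+n (inj here (there x∈p) (sym eq))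
  rest : ∣ p ∣ ≤ ∣ q - f zero ∣
  rest = injection⇒∣p∣≤∣q∣ (f ∘ suc) into′
    λ x∈p y∈p eq → suc-injective (inj (there x∈p) (there y∈p) eq)

surjection⇒∣q∣≤∣p∣ : ∀ (f : Fin k → Fin n) {p q} →
                     (∀ {y} → y ∈ q → ∃ λ x → x ∈ p × f x ≡ y) →
                     ∣ q ∣ ≤ ∣ p ∣
surjection⇒∣q∣≤∣p∣ {n = n} f {[]} {q} onto = ≤-reflexive (trans (cong ∣_∣ q≡⊥) (∣⊥∣≡0 n))
  where
  q≡⊥ : q ≡ ⊥
  q≡⊥ = Empty-unique λ (_ , y∈q) → case onto y∈q of λ ()
surjection⇒∣q∣≤∣p∣ f {outside ∷ p} onto = surjection⇒∣q∣≤∣p∣ (f ∘ suc) onto′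
  where
  onto′ : ∀ {y} → _ → ∃ λ x → x ∈ p × f (suc x) ≡ y
  onto′ y∈q with onto y∈q
  ... | suc x , there x∈p , fx≡y = x , x∈p , fx≡y
surjection⇒∣q∣≤∣p∣ f {inside ∷ p} {q} onto = ≤-trans (∣p∣≤1+∣p-x∣ q (f zero)) (s≤s rest)
  where
  onto′ : ∀ {y} → y ∈ q - f zero → ∃ λ x → x ∈ p × f (suc x) ≡ y
  onto′ {y} y∈q-f0 with onto (p─q⊆p q ⁅ f zero ⁆ y∈q-f0)
  ... | zero  , _           , refl = contradiction y∈q-f0 (x∉p-x (f zero))
  ... | suc x , there x∈p , fx≡y = x , x∈p , fx≡y
  rest : ∣ q - f zero ∣ ≤ ∣ p ∣
  rest = surjection⇒∣q∣≤∣p∣ (f ∘ suc) onto′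

⊆-chain-stabilises : (f : ℕ → Subset n) → (∀ j → f j ⊆ f (suc j)) → ∃ λ J → f (suc J) ⊆ f J
⊆-chain-stabilises {n} f f-mono with stabilises-or-grows (suc n)
  where
  stabilises-or-grows : ∀ i → (∃ λ J → f (suc J) ⊆ f J) ⊎ i ≤ ∣ f i ∣
  stabilises-or-grows zero    = inj₂ z≤n
  stabilises-or-grows (suc i) with stabilises-or-grows i | f i ⊂? f (suc i)
  ... | inj₁ stable | _        = inj₁ stable
  ... | inj₂ i≤∣fi∣ | yes fi⊂  = inj₂ (<-≤-trans (s≤s i≤∣fi∣) (p⊂q⇒∣p∣<∣q∣ fi⊂))
  ... | inj₂ _      | no  fi⊄  = inj₁ (i , shrinks)
    where
    shrinks : f (suc i) ⊆ f i
    shrinks {x} x∈ with x ∈? f i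
    ... | yes x∈fi = x∈fi
    ... | no  x∉fi = contradiction ((λ {y} → f-mono i {y}) , x , x∈ , x∉fi) fi⊄
... | inj₁ stable = stable
... | inj₂ n<∣f∣ = contradiction (≤-trans n<∣f∣ (∣p∣≤n (f (suc n)))) 1+n≰n

∑∈ : Subset n → (Fin n → ℕ) → ℕ
∑∈ []            f = 0
∑∈ (inside  ∷ p) f = f zero + ∑∈ p (f ∘ suc)
∑∈ (outside ∷ p) f = ∑∈ p (f ∘ suc)

syntax ∑∈ p (λ x → e) = ∑[ x ∈ p ] e

*-distribˡ-∑∈ : ∀ c (p : Subset n) (f : Fin n → ℕ) → c * ∑[ x ∈ p ] f x ≡ ∑[ x ∈ p ] (c * f x)
*-distribˡ-∑∈ c []            f = *-zeroʳ c
*-distribˡ-∑∈ c (inside  ∷ p) f =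
  trans (*-distribˡ-+ c (f zero) (∑∈ p (f ∘ suc))) (cong (c * f zero +_) (*-distribˡ-∑∈ c p (f ∘ suc)))
*-distribˡ-∑∈ c (outside ∷ p) f = *-distribˡ-∑∈ c p (f ∘ suc)

∑∈-suc-outside : ∀ (p : Subset n) (c : Fin n → Bool) (f : Fin n → ℕ) →
                 ∑[ x ∈ p ] (if c x then f x else suc (f x)) ≡ ∑[ x ∈ p ] f x + ∣ p ─ tabulate c ∣
∑∈-suc-outside []            c f = refl
∑∈-suc-outside (inside  ∷ p) c f with c zero
... | true  = trans (cong (f zero +_) (∑∈-suc-outside p (c ∘ suc) (f ∘ suc))) (sym (+-assoc (f zero) _ _))
... | false = trans (cong (suc (f zero) +_) (∑∈-suc-outside p (c ∘ suc) (f ∘ suc)))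
                    (trans (sym (+-assoc (suc (f zero)) _ _)) (sym (+-suc _ _)))
∑∈-suc-outside (outside ∷ p) c f with c zero
... | true  = ∑∈-suc-outside p (c ∘ suc) (f ∘ suc)
... | false = ∑∈-suc-outside p (c ∘ suc) (f ∘ suc)

pigeonhole-∑∈ : ∀ (p : Subset n) (f : Fin n → ℕ) {c} → c * ∣ p ∣ < ∑[ x ∈ p ] f x →
                  ∃ λ x → x ∈ p × c < f x
pigeonhole-∑∈ []            f {c} c*0<0 = contradiction (subst (_< 0) (*-zeroʳ c) c*0<0) λ ()
pigeonhole-∑∈ (inside  ∷ p) f {c} c∣p∣<∑ with c <? f zero
... | yes c<f0 = zero , here , c<f0
... | no  c≮f0 with pigeonhole-∑∈ p (f ∘ suc) rest<
  where
  rest< : c * ∣ p ∣ < ∑∈ p (f ∘ suc)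
  rest< = ≰⇒> λ ∑≤ → <⇒≱ (subst (_< f zero + ∑∈ p (f ∘ suc)) (*-suc c ∣ p ∣) c∣p∣<∑)
                           (+-mono-≤ (≮⇒≥ c≮f0) ∑≤)
... | x , x∈p , c<fx = suc x , there x∈p , c<fx
pigeonhole-∑∈ (outside ∷ p) f c∣p∣<∑ with pigeonhole-∑∈ p (f ∘ suc) c∣p∣<∑
... | x , x∈p , c<fx = suc x , there x∈p , c<fx

misses : (ℕ → Fin n → Bool) → ℕ → Fin n → ℕ
misses c zero    x = 0
misses c (suc r) x = if c r x then misses c r x else suc (misses c r x)

frequently-missed : ∀ (p : Subset n) (c : ℕ → Fin n → Bool) {a b} R → 0 < R →
                    (∀ r → r < R → a * ∣ p ∣ < b * ∣ p ─ tabulate (c r) ∣) →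
                    ∃ λ x → x ∈ p × a * R < b * misses c R x
frequently-missed p c {a} {b} (suc R) _ every-round =
  pigeonhole-∑∈ p (λ x → b * misses c (suc R) x) (begin-strict
    a * suc R * ∣ p ∣                                   ≡⟨ cong (_* ∣ p ∣) (*-comm a (suc R)) ⟩
    suc R * a * ∣ p ∣                                   ≡⟨ *-assoc (suc R) a ∣ p ∣ ⟩
    a * ∣ p ∣ + R * (a * ∣ p ∣)                         <⟨ +-mono-<-≤ (every-round R ≤-refl)
                                                                       (accumulated R ≤-refl) ⟩
    b * ∣ p ─ tabulate (c R) ∣ + b * ∑∈ p (misses c R)  ≡⟨ one-more-round R ⟨
    b * ∑∈ p (misses c (suc R))                         ≡⟨ *-distribˡ-∑∈ b p (misses c (suc R)) ⟩
    ∑∈ p (λ x → b * misses c (suc R) x)                 ∎)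
  where
  open ≤-Reasoning
  one-more-round : ∀ r → b * ∑∈ p (misses c (suc r)) ≡
                         b * ∣ p ─ tabulate (c r) ∣ + b * ∑∈ p (misses c r)
  one-more-round r = begin-equality
    b * ∑∈ p (misses c (suc r))                         ≡⟨ cong (b *_) (∑∈-suc-outside p (c r) (misses c r)) ⟩
    b * (∑∈ p (misses c r) + ∣ p ─ tabulate (c r) ∣)    ≡⟨ *-distribˡ-+ b _ _ ⟩
    b * ∑∈ p (misses c r) + b * ∣ p ─ tabulate (c r) ∣  ≡⟨ +-comm (b * ∑∈ p (misses c r)) _ ⟩
    b * ∣ p ─ tabulate (c r) ∣ + b * ∑∈ p (misses c r)  ∎
  accumulated : ∀ r → r ≤ R → r * (a * ∣ p ∣) ≤ b * ∑∈ p (misses c r)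
  accumulated zero    _   = z≤n
  accumulated (suc r) r<R = begin
    a * ∣ p ∣ + r * (a * ∣ p ∣)                         ≤⟨ +-mono-≤ (<⇒≤ (every-round r (m≤n⇒m≤1+n r<R)))
                                                                    (accumulated r (<⇒≤ r<R)) ⟩
    b * ∣ p ─ tabulate (c r) ∣ + b * ∑∈ p (misses c r)  ≡⟨ one-more-round r ⟨
    b * ∑∈ p (misses c (suc r))                         ∎

small-part⇒large-rest : ∀ {a b μ c u} → a ≤ b → μ ≡ c + u → b * c < (b ∸ a) * μ → a * μ < b * u
small-part⇒large-rest {a} {b} {μ} {c} {u} a≤b refl bc<[b-a]μ =
  +-cancelˡ-< (b * c) (a * μ) (b * u) (begin-strict
    b * c + a * μ          <⟨ +-monoˡ-< (a * μ) bc<[b-a]μ ⟩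
    (b ∸ a) * μ + a * μ    ≡⟨ *-distribʳ-+ μ (b ∸ a) a ⟨
    (b ∸ a + a) * μ        ≡⟨ cong (_* μ) (m∸n+n≡m a≤b) ⟩
    b * μ                  ≡⟨ *-distribˡ-+ b c u ⟩
    b * c + b * u          ∎)
  where open ≤-Reasoning

module _ {nL nR m : ℕ} (E : EdgeList nL nR m) where

  left : Fin m → Fin nL
  left = proj₁ ∘ E

  right : Fin m → Fin nR
  right = proj₂ ∘ E

  Matchedˡ : Subset m → Fin nL → Set
  Matchedˡ M x = ∃ λ e → e ∈ M × left e ≡ x

  Matchedʳ : Subset m → Fin nR → Set
  Matchedʳ M y = ∃ λ e → e ∈ M × right e ≡ y

  matchedˡ? : ∀ M → Decidable (Matchedˡ M)
  matchedˡ? M x = any? λ e → e ∈? M ×-dec left e ≟ x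

  matchedʳ? : ∀ M → Decidable (Matchedʳ M)
  matchedʳ? M y = any? λ e → e ∈? M ×-dec right e ≟ y

  coveredEdges : VSet E → Subset m
  coveredEdges U = tabulate (covers E U)

  covers⁺ : ∀ {UL UR e} → left e ∈ UL ⊎ right e ∈ UR → covers E (UL , UR) e ≡ true
  covers⁺ (inj₁ l∈UL) rewrite []=⇒lookup l∈UL = refl
  covers⁺ {UL} {e = e} (inj₂ r∈UR) rewrite []=⇒lookup r∈UR = ∨-zeroʳ (lookup UL (left e))

  covers⁻ : ∀ {UL UR e} → covers E (UL , UR) e ≡ true → left e ∈ UL ⊎ right e ∈ UR
  covers⁻ {UL} {UR} {e} covered with lookup UL (left e) in l∈UL
  ... | true  = inj₁ (lookup⇒[]= (left e) UL l∈UL)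
  ... | false = inj₂ (lookup⇒[]= (right e) UR covered)

  module _ {S M : Subset m} (M-matching : IsMatchingIn E S M) where

    matching-⊆ : ∀ {N} → N ⊆ M → IsMatchingIn E S N
    matching-⊆ N⊆M = proj₁ M-matching ∘ N⊆M , λ e∈N f∈N → proj₂ M-matching (N⊆M e∈N) (N⊆M f∈N)

    left-injective : ∀ {e f} → e ∈ M → f ∈ M → left e ≡ left f → e ≡ f
    left-injective {e} {f} e∈M f∈M le≡lf with e ≟ f
    ... | yes e≡f = e≡f
    ... | no  e≢f = contradiction le≡lf (proj₁ (proj₂ M-matching e∈M f∈M e≢f))

    right-injective : ∀ {e f} → e ∈ M → f ∈ M → right e ≡ right f → e ≡ f
    right-injective {e} {f} e∈M f∈M re≡rf with e ≟ f
    ... | yes e≡f = e≡f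
    ... | no  e≢f = contradiction re≡rf (proj₂ (proj₂ M-matching e∈M f∈M e≢f))

    ∣M∩coveredEdges∣≤vsize : ∀ U → ∣ M ∩ coveredEdges U ∣ ≤ vsize E U
    ∣M∩coveredEdges∣≤vsize (UL , UR) = begin
      ∣ C ∣                 ≡⟨ ∣p∣≡∣p∩q∣+∣p─q∣ C A ⟩
      ∣ C ∩ A ∣ + ∣ C ─ A ∣ ≤⟨ +-mono-≤ ∣C∩A∣≤∣UL∣ ∣C─A∣≤∣UR∣ ⟩
      ∣ UL ∣ + ∣ UR ∣       ∎
      where
      open ≤-Reasoning
      C = M ∩ coveredEdges (UL , UR)
      left∈UL? : Decidable (λ e → left e ∈ UL)
      left∈UL? e = left e ∈? UL
      A = subsetOf left∈UL?
      C⊆M : C ⊆ M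
      C⊆M = p∩q⊆p M _
      C∩A⊆M : C ∩ A ⊆ M
      C∩A⊆M = C⊆M ∘ p∩q⊆p C A
      C─A⊆M : C ─ A ⊆ M
      C─A⊆M = C⊆M ∘ p─q⊆p C A
      into-UL : ∀ {e} → e ∈ C ∩ A → left e ∈ UL
      into-UL e∈ = ∈-subsetOf⁻ left∈UL? (p∩q⊆q C A e∈)
      into-UR : ∀ {e} → e ∈ C ─ A → right e ∈ UR
      into-UR e∈ with covers⁻ {UL} {UR} (∈-tabulate⁻ (p∩q⊆q M _ (p─q⊆p C A e∈)))
      ... | inj₁ l∈UL = contradiction (∈-subsetOf⁺ left∈UL? l∈UL) (x∈p─q⇒x∉q C A e∈)
      ... | inj₂ r∈UR = r∈UR
      ∣C∩A∣≤∣UL∣ : ∣ C ∩ A ∣ ≤ ∣ UL ∣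
      ∣C∩A∣≤∣UL∣ = injection⇒∣p∣≤∣q∣ left into-UL λ e∈ f∈ → left-injective (C∩A⊆M e∈) (C∩A⊆M f∈)
      ∣C─A∣≤∣UR∣ : ∣ C ─ A ∣ ≤ ∣ UR ∣
      ∣C─A∣≤∣UR∣ = injection⇒∣p∣≤∣q∣ right into-UR λ e∈ f∈ → right-injective (C─A⊆M e∈) (C─A⊆M f∈)

    unmatchedˡ-after-removal : ∀ {f} → f ∈ M → ¬ Matchedˡ (M - f) (left f)
    unmatchedˡ-after-removal {f} f∈M (g , g∈M-f , lg≡lf) =
      x∉p-x f (subst (_∈ M - f) (left-injective (p─q⊆p M ⁅ f ⁆ g∈M-f) f∈M lg≡lf) g∈M-f)

    unmatchedʳ-after-removal : ∀ {f} → f ∈ M → ¬ Matchedʳ (M - f) (right f)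
    unmatchedʳ-after-removal {f} f∈M (g , g∈M-f , rg≡rf) =
      x∉p-x f (subst (_∈ M - f) (right-injective (p─q⊆p M ⁅ f ⁆ g∈M-f) f∈M rg≡rf) g∈M-f)

    extend-matching : ∀ {e} → e ∈ S → ¬ Matchedˡ M (left e) → ¬ Matchedʳ M (right e) →
                      IsMatchingIn E S (M ∪ ⁅ e ⁆) × ∣ M ∣ < ∣ M ∪ ⁅ e ⁆ ∣
    extend-matching {e} e∈S l-free r-free = (⊆S , disjoint) , p⊂q⇒∣p∣<∣q∣ M⊂M+e
      where
      cases : ∀ {f} → f ∈ M ∪ ⁅ e ⁆ → f ∈ M ⊎ f ≡ e
      cases = x∈p∪⁅y⁆⇒x∈p⊎x≡y M e
      ⊆S : M ∪ ⁅ e ⁆ ⊆ S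
      ⊆S f∈ with cases f∈
      ... | inj₁ f∈M = proj₁ M-matching f∈M
      ... | inj₂ refl = e∈S
      apart : ∀ {f} → f ∈ M → left f ≢ left e × right f ≢ right e
      apart f∈M = (λ eq → l-free (_ , f∈M , eq)) , (λ eq → r-free (_ , f∈M , eq))
      disjoint : ∀ {f g} → f ∈ M ∪ ⁅ e ⁆ → g ∈ M ∪ ⁅ e ⁆ → f ≢ g →
                 left f ≢ left g × right f ≢ right g
      disjoint f∈ g∈ f≢g with cases f∈ | cases g∈
      ... | inj₁ f∈M | inj₁ g∈M = proj₂ M-matching f∈M g∈M f≢g
      ... | inj₁ f∈M | inj₂ refl = apart f∈M
      ... | inj₂ refl | inj₁ g∈M = map (_∘ sym) (_∘ sym) (apart g∈M)
      ... | inj₂ refl | inj₂ refl = contradiction refl f≢g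
      M⊂M+e : M ⊂ M ∪ ⁅ e ⁆
      M⊂M+e = p⊆p∪q ⁅ e ⁆ , e , x∈p∪q⁺ (inj₂ (x∈⁅x⁆ e)) , λ e∈M → l-free (e , e∈M , refl)

  module _ (S : Subset m) where

    AlternatingStep : Subset m → Subset nL → Fin nL → Set
    AlternatingStep M Z x =
      ∃₂ λ e f → e ∈ S × e ∉ M × left e ∈ Z × f ∈ M × right f ≡ right e × left f ≡ x

    alternatingStep? : ∀ M Z → Decidable (AlternatingStep M Z)
    alternatingStep? M Z x = any? λ e → any? λ f →
      e ∈? S ×-dec ¬? (e ∈? M) ×-dec left e ∈? Z ×-dec f ∈? M ×-dec right f ≟ right e ×-dec left f ≟ x

    -- reach M j: the left vertices joined to an M-unmatched left vertex by an
    -- M-alternating path with at most j matching edges.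
    reach : Subset m → ℕ → Subset nL
    reach M zero    = subsetOf (¬? ∘ matchedˡ? M)
    reach M (suc j) = reach M j ∪ subsetOf (alternatingStep? M (reach M j))

    reach-mono : ∀ M j → reach M j ⊆ reach M (suc j)
    reach-mono M j = p⊆p∪q _

    unmatched⇒∈reach : ∀ {M x} j → ¬ Matchedˡ M x → x ∈ reach M j
    unmatched⇒∈reach zero    x-free = ∈-subsetOf⁺ (¬? ∘ matchedˡ? _) x-free
    unmatched⇒∈reach (suc j) x-free = reach-mono _ j (unmatched⇒∈reach j x-free)

    ∈reach-0⇒unmatched : ∀ {M x} → x ∈ reach M zero → ¬ Matchedˡ M x
    ∈reach-0⇒unmatched = ∈-subsetOf⁻ (¬? ∘ matchedˡ? _)

    step⇒∈reach : ∀ {M x} j → AlternatingStep M (reach M j) x → x ∈ reach M (suc j)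
    step⇒∈reach j step = x∈p∪q⁺ (inj₂ (∈-subsetOf⁺ (alternatingStep? _ _) step))

    ∈reach-suc⁻ : ∀ {M x} j → x ∈ reach M (suc j) → x ∈ reach M j ⊎ AlternatingStep M (reach M j) x
    ∈reach-suc⁻ {M} j x∈ with x∈p∪q⁻ (reach M j) _ x∈
    ... | inj₁ x∈reach = inj₁ x∈reach
    ... | inj₂ x∈step  = inj₂ (∈-subsetOf⁻ (alternatingStep? _ _) x∈step)

    reach-⊆ : ∀ j {M N e} → (∀ {f} → f ∈ N → f ∈ M ⊎ f ≡ e) →
              (∀ {f} → f ∈ M → left f ∈ reach M j → f ∈ N) →
              left e ∉ reach M j → reach M j ⊆ reach N j
    reach-⊆ zero {M} N⊆M+e _ e∉ {x} x∈ = unmatched⇒∈reach zero x-free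
      where
      x-free : ¬ Matchedˡ _ x
      x-free (f , f∈N , lf≡x) with N⊆M+e f∈N
      ... | inj₁ f∈M = ∈reach-0⇒unmatched x∈ (f , f∈M , lf≡x)
      ... | inj₂ refl = e∉ (subst (_∈ reach M zero) (sym lf≡x) x∈)
    reach-⊆ (suc j) {M} {N} {e} N⊆M+e keeps e∉ {x} x∈ = go (∈reach-suc⁻ j x∈)
      where
      ⊆-at-j : reach M j ⊆ reach N j
      ⊆-at-j = reach-⊆ j N⊆M+e (λ f∈M lf∈ → keeps f∈M (reach-mono M j lf∈)) (e∉ ∘ reach-mono M j)
      go : x ∈ reach M j ⊎ AlternatingStep M (reach M j) x → x ∈ reach N (suc j)
      go (inj₁ x∈reach) = reach-mono N j (⊆-at-j x∈reach)
      go (inj₂ (e₁ , f , e₁∈S , e₁∉M , le₁∈ , f∈M , rf≡re₁ , refl)) =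
        step⇒∈reach j (e₁ , f , e₁∈S , e₁∉N , ⊆-at-j le₁∈ , keeps f∈M x∈ , rf≡re₁ , refl)
        where
        e₁∉N : e₁ ∉ N
        e₁∉N e₁∈N with N⊆M+e e₁∈N
        ... | inj₁ e₁∈M = e₁∉M e₁∈M
        ... | inj₂ refl = e∉ (reach-mono M j le₁∈)

    -- Trading the last matching edge f of an alternating path for the edge e at its end
    -- keeps the size of the matching and frees the right vertex one step back.
    flip-matched-edge : ∀ j {M e e₁ f} → IsMatchingIn E S M → e ∈ S → ¬ Matchedʳ M (right e) →
                        left e ∉ reach M j → f ∈ M → left f ≡ left e → right f ≡ right e₁ →
                        left e₁ ∈ reach M j →
                        ∃ λ M′ → IsMatchingIn E S M′ × ∣ M ∣ ≤ ∣ M′ ∣ ×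
                                 left e₁ ∈ reach M′ j × ¬ Matchedʳ M′ (right e₁)
    flip-matched-edge j {M} {e} {e₁} {f} M-matching e∈S re-free le∉reach f∈M lf≡le rf≡re₁ le₁∈ =
      M′ , proj₁ extended , M≤M′ , reach-⊆ j M′⊆M+e keeps le∉reach le₁∈ , re₁-free
      where
      extended = extend-matching (matching-⊆ M-matching (p─q⊆p M ⁅ f ⁆)) e∈S
        (subst (¬_ ∘ Matchedˡ (M - f)) lf≡le (unmatchedˡ-after-removal M-matching f∈M))
        (λ (g , g∈ , rg≡re) → re-free (g , p─q⊆p M ⁅ f ⁆ g∈ , rg≡re))
      M′ = (M - f) ∪ ⁅ e ⁆
      M≤M′ : ∣ M ∣ ≤ ∣ M′ ∣
      M≤M′ = ≤-trans (∣p∣≤1+∣p-x∣ M f) (proj₂ extended)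
      M′⊆M+e : ∀ {g} → g ∈ M′ → g ∈ M ⊎ g ≡ e
      M′⊆M+e g∈M′ with x∈p∪⁅y⁆⇒x∈p⊎x≡y (M - f) e g∈M′
      ... | inj₁ g∈M-f = inj₁ (p─q⊆p M ⁅ f ⁆ g∈M-f)
      ... | inj₂ g≡e   = inj₂ g≡e
      keeps : ∀ {g} → g ∈ M → left g ∈ reach M j → g ∈ M′
      keeps g∈M lg∈ = x∈p∪q⁺ (inj₁ (x∈p∧x≢y⇒x∈p-y g∈M
        λ { refl → le∉reach (subst (_∈ reach M j) lf≡le lg∈) }))
      re₁-free : ¬ Matchedʳ M′ (right e₁)
      re₁-free (g , g∈M′ , rg≡re₁) with x∈p∪⁅y⁆⇒x∈p⊎x≡y (M - f) e g∈M′
      ... | inj₁ g∈M-f = unmatchedʳ-after-removal M-matching f∈M (g , g∈M-f , trans rg≡re₁ (sym rf≡re₁))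
      ... | inj₂ refl  = re-free (f , f∈M , trans rf≡re₁ (sym rg≡re₁))

    augment : ∀ j {M e} → IsMatchingIn E S M → e ∈ S → left e ∈ reach M j → ¬ Matchedʳ M (right e) →
              ∃ λ N → IsMatchingIn E S N × ∣ M ∣ < ∣ N ∣
    augment zero {M} {e} M-matching e∈S le∈ re-free =
      M ∪ ⁅ e ⁆ , extend-matching M-matching e∈S (∈reach-0⇒unmatched le∈) re-free
    augment (suc j) {M} {e} M-matching e∈S le∈ re-free with left e ∈? reach M j | ∈reach-suc⁻ j le∈
    ... | yes le∈reach | _ = augment j M-matching e∈S le∈reach re-free
    ... | no  le∉reach | inj₁ le∈reach = contradiction le∈reach le∉reach
    ... | no  le∉reach | inj₂ (e₁ , f , e₁∈S , _ , le₁∈ , f∈M , rf≡re₁ , lf≡le)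
      with flip-matched-edge j M-matching e∈S re-free le∉reach f∈M lf≡le rf≡re₁ le₁∈
    ...   | M′ , M′-matching , M≤M′ , le₁∈′ , re₁-free
      with augment j M′-matching e₁∈S le₁∈′ re₁-free
    ...   | N , N-matching , M′<N = N , N-matching , ≤-<-trans M≤M′ M′<N

    neighbour? : ∀ Z → Decidable (λ y → ∃ λ e → e ∈ S × left e ∈ Z × right e ≡ y)
    neighbour? Z y = any? λ e → e ∈? S ×-dec left e ∈? Z ×-dec right e ≟ y

    neighbours : Subset nL → Subset nR
    neighbours Z = subsetOf (neighbour? Z)

    ∁-neighbours-cover : ∀ Z → IsVertexCoverOf E S (∁ Z , neighbours Z)
    ∁-neighbours-cover Z {e} e∈S with left e ∈? Z
    ... | yes le∈Z = covers⁺ {∁ Z} (inj₂ (∈-subsetOf⁺ (neighbour? Z) (e , e∈S , le∈Z , refl)))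
    ... | no  le∉Z = covers⁺ {UR = neighbours Z} (inj₁ (x∉p⇒x∈∁p le∉Z))

    ∣∁-neighbours∣≤∣M∣ : ∀ {M Z} → IsMatchingIn E S M →
                         (∀ {x} → ¬ Matchedˡ M x → x ∈ Z) →
                         (∀ {x} → AlternatingStep M Z x → x ∈ Z) →
                         (∀ {e} → e ∈ S → left e ∈ Z → Matchedʳ M (right e)) →
                         vsize E (∁ Z , neighbours Z) ≤ ∣ M ∣
    ∣∁-neighbours∣≤∣M∣ {M} {Z} M-matching unmatched⊆Z closed matched = begin
      ∣ ∁ Z ∣ + ∣ neighbours Z ∣ ≤⟨ +-mono-≤ (surjection⇒∣q∣≤∣p∣ left onto-∁Z)
                                             (surjection⇒∣q∣≤∣p∣ right onto-neighbours) ⟩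
      ∣ M ─ A ∣ + ∣ M ∩ A ∣      ≡⟨ +-comm ∣ M ─ A ∣ ∣ M ∩ A ∣ ⟩
      ∣ M ∩ A ∣ + ∣ M ─ A ∣      ≡⟨ ∣p∣≡∣p∩q∣+∣p─q∣ M A ⟨
      ∣ M ∣                      ∎
      where
      open ≤-Reasoning
      left∈Z? : Decidable (λ e → left e ∈ Z)
      left∈Z? e = left e ∈? Z
      A = subsetOf left∈Z?
      onto-∁Z : ∀ {x} → x ∈ ∁ Z → ∃ λ f → f ∈ M ─ A × left f ≡ x
      onto-∁Z {x} x∈∁Z with matchedˡ? M x
      ... | yes (f , f∈M , refl) =
        f , x∈p∧x∉q⇒x∈p─q f∈M (x∈∁p⇒x∉p x∈∁Z ∘ ∈-subsetOf⁻ left∈Z?) , refl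
      ... | no  x-free           = contradiction (unmatched⊆Z x-free) (x∈∁p⇒x∉p x∈∁Z)
      onto-neighbours : ∀ {y} → y ∈ neighbours Z → ∃ λ f → f ∈ M ∩ A × right f ≡ y
      onto-neighbours y∈ with ∈-subsetOf⁻ (neighbour? Z) y∈
      ... | e , e∈S , le∈Z , refl with matched e∈S le∈Z
      ... | f , f∈M , rf≡re = f , x∈p∩q⁺ (f∈M , ∈-subsetOf⁺ left∈Z? lf∈Z) , rf≡re
        where
        lf∈Z : left f ∈ Z
        lf∈Z with e ∈? M
        ... | yes e∈M = subst (λ g → left g ∈ Z) (right-injective M-matching e∈M f∈M (sym rf≡re)) le∈Z
        ... | no  e∉M = closed (e , f , e∈S , e∉M , le∈Z , f∈M , rf≡re , refl)

    kőnig : ∀ {M} → IsMaximumMatchingIn E S M → ∃ λ W → IsVertexCoverOf E S W × vsize E W ≤ ∣ M ∣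
    kőnig {M} (M-matching , M-maximum) with ⊆-chain-stabilises (reach M) (reach-mono M)
    ... | J , stable = (∁ Z , neighbours Z) , ∁-neighbours-cover Z ,
                       ∣∁-neighbours∣≤∣M∣ M-matching (unmatched⇒∈reach J) (stable ∘ step⇒∈reach J) matched
      where
      Z = reach M J
      matched : ∀ {e} → e ∈ S → left e ∈ Z → Matchedʳ M (right e)
      matched {e} e∈S le∈Z with matchedʳ? M (right e)
      ... | yes right-matched = right-matched
      ... | no  right-free    = let (N , N-matching , M<N) = augment J M-matching e∈S le∈Z right-free
                                in contradiction (M-maximum N N-matching) (<⇒≱ M<N)

    minimumCover≤maximumMatching : ∀ {M U} → IsMaximumMatchingIn E S M → IsMinimumVertexCoverOf E S U →
                                   vsize E U ≤ ∣ M ∣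
    minimumCover≤maximumMatching M-maximum (_ , U-minimum) =
      let (W , W-cover , W≤M) = kőnig M-maximum in ≤-trans (U-minimum W W-cover) W≤M

module _ {nL nR m : ℕ} (E : EdgeList nL nR m) (U : ℕ → VSet E) where

  importance≡2^misses : ∀ r e → importance E U r e ≡ 2 ^ misses (λ r → covers E (U r)) r e
  importance≡2^misses zero    e = refl
  importance≡2^misses (suc r) e with covers E (U r) e
  ... | true  = importance≡2^misses r e
  ... | false = cong (2 *_) (importance≡2^misses r e)

  2^≤importance^b : ∀ b R e {x} → x ≤ b * misses (λ r → covers E (U r)) R e →
                    2 ^ x ≤ importance E U R e ^ b
  2^≤importance^b b R e {x} x≤bk = begin
    2 ^ x          ≤⟨ ^-monoʳ-≤ 2 (≤-trans x≤bk (≤-reflexive (*-comm b t))) ⟩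
    2 ^ (t * b)    ≡⟨ ^-*-assoc 2 t b ⟨
    (2 ^ t) ^ b    ≡⟨ cong (_^ b) (importance≡2^misses R e) ⟨
    importance E U R e ^ b ∎
    where
    open ≤-Reasoning
    t = misses (λ r → covers E (U r)) R e

lemma3p3 : (nL nR m : ℕ) (E : EdgeList nL nR m) → Injective _≡_ _≡_ E
    → 0 < m
    -- ε = a / b ∈ (0,1)
    → (a b : ℕ) → 0 < a → a < b
    -- number of rounds R with ε·R ≥ 4 log₂ m, i.e. 2^(ε R) ≥ m^4
    → (R : ℕ) → m ^ (4 * b) ≤ 2 ^ (a * R)
    -- μ(G) = size of a maximum matching of G
    → (Mstar : Subset m) → IsMaximumMatchingIn E ⊤ Mstar
    -- an arbitrary outcome of the sampling, with the computed matchings / covers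
    → (S : ℕ → Subset m) (M : ℕ → Subset m) (U : ℕ → VSet E)
    → (∀ r → r < R → IsMaximumMatchingIn E (S r) (M r))
    → (∀ r → r < R → IsMinimumVertexCoverOf E (S r) (U r))
    -- |M^(r)| < (1 - ε) μ(G) in every iteration
    → (∀ r → r < R → b * ∣ M r ∣ < (b ∸ a) * ∣ Mstar ∣)
    -- some edge has q^(R+1)_e ≥ 2^(ε R)
    → Σ (Fin m) λ e → 2 ^ (a * R) ≤ importance E U R e ^ b
lemma3p3 _ _ _ E _ 0<m a b _ _ zero _ _ _ _ _ U _ _ _ =
  fromℕ< 0<m , 2^≤importance^b E U b 0 (fromℕ< 0<m) (≤-reflexive (trans (*-zeroʳ a) (sym (*-zeroʳ b))))
lemma3p3 _ _ _ E _ _ a b _ a<b R@(suc _) _ M* (M*-matching , _) S M U M-maximum U-minimum M-small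
  with frequently-missed M* (λ r → covers E (U r)) {a} {b} R z<s every-round
  where
  every-round : ∀ r → r < R → a * ∣ M* ∣ < b * ∣ M* ─ coveredEdges E (U r) ∣
  every-round r r<R = small-part⇒large-rest (<⇒≤ a<b) (∣p∣≡∣p∩q∣+∣p─q∣ M* (coveredEdges E (U r)))
    (≤-<-trans (*-monoʳ-≤ b covered≤M) (M-small r r<R))
    where
    covered≤M : ∣ M* ∩ coveredEdges E (U r) ∣ ≤ ∣ M r ∣
    covered≤M = ≤-trans (∣M∩coveredEdges∣≤vsize E M*-matching (U r))
                        (minimumCover≤maximumMatching E (S r) {U = U r} (M-maximum r r<R) (U-minimum r r<R))
... | e , _ , aR<bk = e , 2^≤importance^b E U b R e (<⇒≤ aR<bk)
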